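{- Let $n \geqslant 1$, let $\sigma$ be an inversion sequence of size $n$ which avoids $010$ and $102$ and contains no entry equal to $1$, and let $z = |\mathbf{Zeros}(\sigma)|$. Then $$\mathbf{Sites}(\sigma) = \{i \in [z+1,n+1] \; : \; \min((\sigma_j)_{j \in [z+1,i-1]}) \geqslant \max((\sigma_j)_{j \in [i,n]})\},$$ with the conventions that the minimum of the empty sequence is $+\infty$ and the maximum of the empty sequence is $-1$.
   Context: An inversion sequence of size $n$ is a sequence $\sigma=(\sigma_1,\dots,\sigma_n)$ of integers with $\sigma_i\in\{0,\dots,i-1\}$. A sequence contains $010$ if it has entries at positions $a<b<c$ with $\sigma_a=\sigma_c<\sigma_b$, and contains $102$ if it has entries at positions $a<b<c$ with $\sigma_b<\sigma_a<\sigma_c$; otherwise it avoids them. $\mathbf{Zeros}(\sigma)$ is the set of positions of zero entries. For an inversion sequence $\sigma$ of size $n$ avoiding $010$ and $102$, $\mathbf{Sites}(\sigma)$ (the active sites) is the set of $i\in[2,n+1]$ such that the sequence $(\sigma_1,\dots,\sigma_{i-1},1,\sigma_i,\dots,\sigma_n)$ (inserting an entry $1$ at position $i$) is an inversion sequence of size $n+1$ avoiding $010$ and $102$. -}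

module Defs where

open import Data.Nat using (ℕ; zero; suc; _+_; _∸_; _≤_; _<_; _⊓_; _⊔_; _≟_; _<ᵇ_; _≡ᵇ_)
open import Data.Bool using (if_then_else_)
open import Data.List using (List; []; _∷_; map; filter; length; applyUpTo)
open import Data.Maybe using (Maybe; just; nothing; maybe)
open import Data.Product using (∃-syntax; _×_)
open import Data.Unit using (⊤)
open import Relation.Nullary using (¬_)
open import Relation.Binary.PropositionalEquality using (_≡_; _≢_)

-- A sequence of size n is a function σ : ℕ → ℕ of which only the values
-- σ 1, …, σ n (1-indexed positions) are relevant.
Seq : Set
Seq = ℕ → ℕ

IsInvSeq : ℕ → Seq → Set
IsInvSeq n σ = ∀ i → 1 ≤ i → i ≤ n → σ i < i

Contains010 : ℕ → Seq → Set
Contains010 n σ = ∃[ a ] ∃[ b ] ∃[ c ]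
  (1 ≤ a × a < b × b < c × c ≤ n × σ a ≡ σ c × σ c < σ b)

Contains102 : ℕ → Seq → Set
Contains102 n σ = ∃[ a ] ∃[ b ] ∃[ c ]
  (1 ≤ a × a < b × b < c × c ≤ n × σ b < σ a × σ a < σ c)

IsAvoider : ℕ → Seq → Set
IsAvoider n σ = IsInvSeq n σ × ¬ Contains010 n σ × ¬ Contains102 n σ

-- the list of integers a, a+1, …, b  (empty if b < a)
range : ℕ → ℕ → List ℕ
range a b = applyUpTo (a +_) (suc b ∸ a)

Zeros : ℕ → Seq → List ℕ
Zeros n σ = filter (λ j → σ j ≟ 0) (range 1 n)

insertOne : Seq → ℕ → Seq
insertOne σ i j = if j <ᵇ i then σ j else (if j ≡ᵇ i then 1 else σ (j ∸ 1))

Sites : ℕ → Seq → ℕ → Set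
Sites n σ i = 2 ≤ i × i ≤ suc n × IsAvoider (suc n) (insertOne σ i)

-- minimum of a list; nothing encodes +∞ (minimum of the empty sequence)
minimum∞ : List ℕ → Maybe ℕ
minimum∞ [] = nothing
minimum∞ (x ∷ xs) = just (maybe (x ⊓_) x (minimum∞ xs))

-- maximum of a list; nothing encodes -1 (maximum of the empty sequence)
maximum₋₁ : List ℕ → Maybe ℕ
maximum₋₁ [] = nothing
maximum₋₁ (x ∷ xs) = just (maybe (x ⊔_) x (maximum₋₁ xs))

-- m ≥ M where m ∈ ℕ ∪ {+∞} (nothing = +∞) and M ∈ ℕ ∪ {-1} (nothing = -1)
MinGeMax : Maybe ℕ → Maybe ℕ → Set
MinGeMax nothing  _        = ⊤
MinGeMax (just m) nothing  = ⊤
MinGeMax (just m) (just M) = M ≤ m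

rangeMin : Seq → ℕ → ℕ → Maybe ℕ
rangeMin σ a b = minimum∞ (map σ (range a b))

rangeMax : Seq → ℕ → ℕ → Maybe ℕ
rangeMax σ a b = maximum₋₁ (map σ (range a b))

{-# OPTIONS --safe #-}
-- An inversion sequence starts with σ₁ = 0, so as σ avoids 010 its zeros are exactly
-- σ₁, …, σ_z, and as it has no entry 1 all later entries are at least 2. Inserting 1 at
-- position i then creates a 010 exactly when a zero follows it (i ≤ z), and a 102 exactly when
-- some σ_p with z < p < i is smaller than some σ_q with q ≥ i, the occurrence being
-- (σ_p, 1, σ_q). Any other occurrence avoids the inserted entry, so it is already one in σ.
module Submission where

open import Defs
open import Data.Nat
  using (ℕ; zero; suc; pred; _+_; _∸_; _≤_; _<_; _⊓_; _⊔_; _<ᵇ_; _≡ᵇ_;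
         z≤n; s≤s; z<s; s<s; s≤s⁻¹; s<s⁻¹; >-nonZero)
open import Data.Nat.Properties
open import Data.Bool using (true; false)
open import Data.List using (List; []; _∷_; map; filter; length; applyUpTo)
open import Data.List.Properties using (length-filter; length-applyUpTo)
open import Data.List.Membership.Propositional using (_∈_)
open import Data.List.Membership.Propositional.Properties
  using (∈-map⁺; ∈-map⁻; ∈-applyUpTo⁺; ∈-applyUpTo⁻)
open import Data.List.Relation.Unary.Any using (here; there)
open import Data.Maybe using (maybe)
open import Data.Product using (_×_; _,_; proj₁; proj₂; ∃-syntax)
open import Data.Sum using (inj₁; inj₂)
open import Data.Unit using (tt)
open import Function.Base using (_∘_)
open import Function.Bundles using (_⇔_; mk⇔; Equivalence)
open import Level using (Level)
open import Relation.Nullary using (¬_; yes; no; contradiction)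
open import Relation.Nullary.Reflects using (ofʸ; ofⁿ)
open import Relation.Unary using (Pred; Decidable)
open import Relation.Binary using (tri<; tri≈; tri>)
open import Relation.Binary.PropositionalEquality
  using (_≡_; _≢_; refl; sym; trans; cong; subst; subst₂)

subst₃ : ∀ {a b c ℓ} {A : Set a} {B : Set b} {C : Set c} (R : A → B → C → Set ℓ)
         {x x′ y y′ z z′} → x ≡ x′ → y ≡ y′ → z ≡ z′ → R x y z → R x′ y′ z′
subst₃ R refl refl refl r = r

-- minimum∞ (x ∷ xs) reduces to just (min∷ x xs), and maximum₋₁ (x ∷ xs) to just (max∷ x xs).
min∷ : ℕ → List ℕ → ℕ
min∷ x xs = maybe (x ⊓_) x (minimum∞ xs)

max∷ : ℕ → List ℕ → ℕ
max∷ x xs = maybe (x ⊔_) x (maximum₋₁ xs)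

min∷-≤ : ∀ x xs {y} → y ∈ x ∷ xs → min∷ x xs ≤ y
min∷-≤ x []       (here refl) = ≤-refl
min∷-≤ x (w ∷ ws) (here refl) = m⊓n≤m x (min∷ w ws)
min∷-≤ x (w ∷ ws) (there y∈)  = ≤-trans (m⊓n≤n x (min∷ w ws)) (min∷-≤ w ws y∈)

min∷-∈ : ∀ x xs → min∷ x xs ∈ x ∷ xs
min∷-∈ x []       = here refl
min∷-∈ x (w ∷ ws) with ⊓-sel x (min∷ w ws)
... | inj₁ x⊓m≡x = here x⊓m≡x
... | inj₂ x⊓m≡m = there (subst (_∈ w ∷ ws) (sym x⊓m≡m) (min∷-∈ w ws))

max∷-≥ : ∀ x xs {y} → y ∈ x ∷ xs → y ≤ max∷ x xs
max∷-≥ x []       (here refl) = ≤-refl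
max∷-≥ x (w ∷ ws) (here refl) = m≤m⊔n x (max∷ w ws)
max∷-≥ x (w ∷ ws) (there y∈)  = ≤-trans (max∷-≥ w ws y∈) (m≤n⊔m x (max∷ w ws))

max∷-∈ : ∀ x xs → max∷ x xs ∈ x ∷ xs
max∷-∈ x []       = here refl
max∷-∈ x (w ∷ ws) with ⊔-sel x (max∷ w ws)
... | inj₁ x⊔m≡x = here x⊔m≡x
... | inj₂ x⊔m≡m = there (subst (_∈ w ∷ ws) (sym x⊔m≡m) (max∷-∈ w ws))

MinGeMax⇔ : ∀ xs ys →
  MinGeMax (minimum∞ xs) (maximum₋₁ ys) ⇔ (∀ {x y} → x ∈ xs → y ∈ ys → y ≤ x)
MinGeMax⇔ []       _        = mk⇔ (λ _ {_} {_} ()) (λ _ → tt)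
MinGeMax⇔ (_ ∷ _)  []       = mk⇔ (λ _ {_} {_} _ ()) (λ _ → tt)
MinGeMax⇔ (x ∷ xs) (y ∷ ys) = mk⇔
  (λ M≤m {_} {_} x∈ y∈ → ≤-trans (max∷-≥ y ys y∈) (≤-trans M≤m (min∷-≤ x xs x∈)))
  (λ below → below (min∷-∈ x xs) (max∷-∈ y ys))

∈-range⁺ : ∀ {a b p} → a ≤ p → p ≤ b → p ∈ range a b
∈-range⁺ {a} {b} a≤p p≤b = subst (_∈ range a b) (m+[n∸m]≡n a≤p)
  (∈-applyUpTo⁺ (a +_) (∸-monoˡ-< (s≤s p≤b) a≤p))

∈-range⁻ : ∀ {a b p} → p ∈ range a b → a ≤ p × p ≤ b
∈-range⁻ {a} {b} p∈ with ∈-applyUpTo⁻ (a +_) p∈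
... | k , k<len , refl = m≤m+n a k , subst (_≤ b) (+-comm k a) (s≤s⁻¹ k+1+a≤1+b)
  where
  a<1+b : a < suc b
  a<1+b = m∸n≢0⇒n<m (λ len≡0 → n≮0 (subst (k <_) len≡0 k<len))
  k+1+a≤1+b : suc k + a ≤ suc b
  k+1+a≤1+b = m≤o∸n⇒m+n≤o (suc k) (<⇒≤ a<1+b) k<len

Dominates : Seq → ℕ → ℕ → ℕ → ℕ → Set
Dominates σ a b c d = ∀ {p q} → a ≤ p → p ≤ b → c ≤ q → q ≤ d → σ q ≤ σ p

MinGeMax-range⇔ : ∀ {σ a b c d} →
  MinGeMax (rangeMin σ a b) (rangeMax σ c d) ⇔ Dominates σ a b c d
MinGeMax-range⇔ {σ} {a} {b} {c} {d} = mk⇔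
  (λ m≥M {_} {_} a≤p p≤b c≤q q≤d →
     to m≥M (∈-map⁺ σ (∈-range⁺ a≤p p≤b)) (∈-map⁺ σ (∈-range⁺ c≤q q≤d)))
  (λ dominates → from (λ {_} {_} → entries dominates))
  where
  open Equivalence (MinGeMax⇔ (map σ (range a b)) (map σ (range c d)))
  entries : Dominates σ a b c d →
    ∀ {x y} → x ∈ map σ (range a b) → y ∈ map σ (range c d) → y ≤ x
  entries dominates x∈ y∈ with ∈-map⁻ σ x∈ | ∈-map⁻ σ y∈
  ... | p , p∈ , refl | q , q∈ , refl with ∈-range⁻ p∈ | ∈-range⁻ q∈
  ... | a≤p , p≤b | c≤q , q≤d = dominates a≤p p≤b c≤q q≤d

module _ {a ℓ : Level} {A : Set a} {P : Pred A ℓ} (P? : Decidable P) where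

  PrefixClosed : (ℕ → A) → ℕ → Set ℓ
  PrefixClosed f m = ∀ {j k} → j < k → k < m → P (f k) → P (f j)

  private
    tail : ∀ {f m} → PrefixClosed f (suc m) → PrefixClosed (f ∘ suc) m
    tail closed j<k k<m = closed (s<s j<k) (s<s k<m)

  length-filter-applyUpTo≤ : ∀ f m → length (filter P? (applyUpTo f m)) ≤ m
  length-filter-applyUpTo≤ f m =
    subst (length (filter P? (applyUpTo f m)) ≤_) (length-applyUpTo f m)
      (length-filter P? (applyUpTo f m))

  satisfies⇒<length-filter : ∀ {f m j} → PrefixClosed f m →
    j < m → P (f j) → j < length (filter P? (applyUpTo f m))
  satisfies⇒<length-filter {f} {suc m} {j} closed j<m pj with P? (f 0) | j
  ... | yes _   | zero   = z<s
  ... | yes _   | suc j′ = s<s (satisfies⇒<length-filter (tail closed) (s<s⁻¹ j<m) pj)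
  ... | no ¬p₀  | zero   = contradiction pj ¬p₀
  ... | no ¬p₀  | suc _  = contradiction (closed z<s j<m pj) ¬p₀

  <length-filter⇒satisfies : ∀ {f m j} → PrefixClosed f m →
    j < length (filter P? (applyUpTo f m)) → P (f j)
  <length-filter⇒satisfies {f} {suc m} {j} closed j<len with P? (f 0) | j
  ... | yes p₀ | zero   = p₀
  ... | yes _  | suc j′ = <length-filter⇒satisfies (tail closed) (s<s⁻¹ j<len)
  ... | no ¬p₀ | j′     = contradiction (closed z<s (s<s j′<m) p[1+j′]) ¬p₀
    where
    p[1+j′] : P (f (suc j′))
    p[1+j′] = <length-filter⇒satisfies (tail closed) j<len
    j′<m : j′ < m
    j′<m = <-≤-trans j<len (length-filter-applyUpTo≤ (f ∘ suc) m)

insertOne-< : ∀ σ {i j} → j < i → insertOne σ i j ≡ σ j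
insertOne-< σ {i} {j} j<i with j <ᵇ i | <ᵇ-reflects-< j i
... | true  | _        = refl
... | false | ofⁿ j≮i  = contradiction j<i j≮i

insertOne-≡ : ∀ σ i → insertOne σ i i ≡ 1
insertOne-≡ σ i with i <ᵇ i | <ᵇ-reflects-< i i
... | true  | ofʸ i<i = contradiction i<i (<-irrefl refl)
... | false | _ with i ≡ᵇ i | ≡⇒≡ᵇ i i refl
...   | true  | _  = refl
...   | false | ()

insertOne-> : ∀ σ {i j} → i < j → insertOne σ i j ≡ σ (pred j)
insertOne-> σ {i} {j} i<j with j <ᵇ i | <ᵇ-reflects-< j i
... | true  | ofʸ j<i = contradiction j<i (<-asym i<j)
... | false | _ with j ≡ᵇ i | ≡ᵇ⇒≡ j i
...   | true  | j≡ᵇi = contradiction (j≡ᵇi tt) (>⇒≢ i<j)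
...   | false | _    = refl

insertOne-isInvSeq : ∀ {n σ i} → 1 < i → i ≤ suc n →
  IsInvSeq n σ → IsInvSeq (suc n) (insertOne σ i)
insertOne-isInvSeq {n} {σ} {i} 1<i i≤1+n isInv (suc j) _ j<2+n with <-cmp (suc j) i
... | tri< j<i _ _ rewrite insertOne-< σ j<i =
  isInv (suc j) (s≤s z≤n) (s≤s⁻¹ (<-≤-trans j<i i≤1+n))
... | tri≈ _ refl _ rewrite insertOne-≡ σ (suc j) = 1<i
... | tri> _ _ i<j rewrite insertOne-> σ i<j =
  m<n⇒m<1+n (isInv j (≤-trans (<⇒≤ 1<i) (s≤s⁻¹ i<j)) (s≤s⁻¹ j<2+n))

punchOut : ℕ → ℕ → ℕ
punchOut zero    p       = pred p
punchOut (suc i) zero    = zero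
punchOut (suc i) (suc p) = suc (punchOut i p)

punchOut-< : ∀ {i p} → p < i → punchOut i p ≡ p
punchOut-< {suc i} {zero}  _   = refl
punchOut-< {suc i} {suc p} p<i = cong suc (punchOut-< (s<s⁻¹ p<i))

punchOut-> : ∀ {i p} → i < p → punchOut i p ≡ pred p
punchOut-> {zero}  {suc p}       _         = refl
punchOut-> {suc i} {suc (suc p)} (s<s i<p) = cong suc (punchOut-> i<p)

punchOut-mono-< : ∀ {i p q} → p ≢ i → q ≢ i → p < q → punchOut i p < punchOut i q
punchOut-mono-< {zero}  {zero}          p≢i _ _         = contradiction refl p≢i
punchOut-mono-< {zero}  {suc p} {suc q} _   _ (s<s p<q) = p<q
punchOut-mono-< {suc i} {zero}  {suc q} _   _ _         = z<s
punchOut-mono-< {suc i} {suc p} {suc q} p≢i q≢i (s<s p<q) =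
  s<s (punchOut-mono-< (p≢i ∘ cong suc) (q≢i ∘ cong suc) p<q)

punchOut-pos : ∀ {i p} → 1 ≤ i → 1 ≤ p → 1 ≤ punchOut i p
punchOut-pos {suc i} {suc p} _ _ = s≤s z≤n

punchOut-≤ : ∀ {n i p} → p ≢ i → p ≤ suc n → i ≤ suc n → punchOut i p ≤ n
punchOut-≤ {n}     {zero}  _   p≤1+n _ = pred-mono-≤ p≤1+n
punchOut-≤ {n}     {suc i} {zero}  _ _ _ = z≤n
punchOut-≤ {zero}  {suc i} {suc p} p≢i (s≤s z≤n) (s≤s z≤n) = contradiction refl p≢i
punchOut-≤ {suc n} {suc i} {suc p} p≢i (s≤s p≤1+n) (s≤s i≤1+n) =
  s≤s (punchOut-≤ (p≢i ∘ cong suc) p≤1+n i≤1+n)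

insertOne-punchOut : ∀ σ {i p} → p ≢ i → insertOne σ i p ≡ σ (punchOut i p)
insertOne-punchOut σ {i} {p} p≢i with <-cmp p i
... | tri< p<i _ _ = trans (insertOne-< σ p<i) (cong σ (sym (punchOut-< p<i)))
... | tri≈ _ p≡i _ = contradiction p≡i p≢i
... | tri> _ _ i<p = trans (insertOne-> σ i<p) (cong σ (sym (punchOut-> i<p)))

Pattern : Set₁
Pattern = ℕ → ℕ → ℕ → Set

Pattern010 : Pattern
Pattern010 x y z = x ≡ z × z < y

Pattern102 : Pattern
Pattern102 x y z = y < x × x < z

-- Contains010 and Contains102 are definitionally Contains Pattern010 and Contains Pattern102.
Occurs : Pattern → ℕ → Seq → ℕ → ℕ → ℕ → Set
Occurs R n σ a b c = 1 ≤ a × a < b × b < c × c ≤ n × R (σ a) (σ b) (σ c)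

Contains : Pattern → ℕ → Seq → Set
Contains R n σ = ∃[ a ] ∃[ b ] ∃[ c ] Occurs R n σ a b c

occurs-punchOut : ∀ {R n σ i a b c} → 1 ≤ i → i ≤ suc n → a ≢ i → b ≢ i → c ≢ i →
  Occurs R (suc n) (insertOne σ i) a b c →
  Occurs R n σ (punchOut i a) (punchOut i b) (punchOut i c)
occurs-punchOut {R} {σ = σ} 1≤i i≤1+n a≢i b≢i c≢i (1≤a , a<b , b<c , c≤1+n , r) =
  punchOut-pos 1≤i 1≤a , punchOut-mono-< a≢i b≢i a<b , punchOut-mono-< b≢i c≢i b<c ,
  punchOut-≤ c≢i c≤1+n i≤1+n ,
  subst₃ R (insertOne-punchOut σ a≢i) (insertOne-punchOut σ b≢i) (insertOne-punchOut σ c≢i) r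

insertOne-avoids : ∀ {R n σ i} → 1 ≤ i → i ≤ suc n → ¬ Contains R n σ →
  (∀ {b c} → ¬ Occurs R (suc n) (insertOne σ i) i b c) →
  (∀ {a c} → ¬ Occurs R (suc n) (insertOne σ i) a i c) →
  (∀ {a b} → ¬ Occurs R (suc n) (insertOne σ i) a b i) →
  ¬ Contains R (suc n) (insertOne σ i)
insertOne-avoids {R} {σ = σ} {i} 1≤i i≤1+n avoids first middle last (a , b , c , occ)
  with a ≟ i | b ≟ i | c ≟ i
... | yes refl | _        | _        = first occ
... | _        | yes refl | _        = middle occ
... | _        | _        | yes refl = last occ
... | no a≢i   | no b≢i   | no c≢i   =
  avoids (_ , _ , _ , occurs-punchOut {R} {σ = σ} 1≤i i≤1+n a≢i b≢i c≢i occ)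

module ZeroPrefix {n : ℕ} {σ : Seq} (σ₁≡0 : σ 1 ≡ 0) (avoids010 : ¬ Contains010 n σ) where

  #zeros : ℕ
  #zeros = length (Zeros n σ)

  zerosPrefixClosed : PrefixClosed (λ j → σ j ≟ 0) suc n
  zerosPrefixClosed {zero}  _   _   _     = σ₁≡0
  zerosPrefixClosed {suc j} {k} j<k k<n σk≡0 with σ (suc (suc j)) ≟ 0
  ... | yes σ≡0 = σ≡0
  ... | no  σ≢0 = contradiction
    (1 , suc (suc j) , suc k , ≤-refl , s<s z<s , s<s j<k , k<n ,
     trans σ₁≡0 (sym σk≡0) , subst (_< σ (suc (suc j))) (sym σk≡0) (n≢0⇒n>0 σ≢0))
    avoids010

  #zeros≤n : #zeros ≤ n
  #zeros≤n = length-filter-applyUpTo≤ (λ j → σ j ≟ 0) suc n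

  zero⇒≤#zeros : ∀ {p} → 1 ≤ p → p ≤ n → σ p ≡ 0 → p ≤ #zeros
  zero⇒≤#zeros {suc _} _ p≤n σp≡0 =
    satisfies⇒<length-filter (λ j → σ j ≟ 0) zerosPrefixClosed p≤n σp≡0

  ≤#zeros⇒zero : ∀ {p} → 1 ≤ p → p ≤ #zeros → σ p ≡ 0
  ≤#zeros⇒zero {suc _} _ p≤z = <length-filter⇒satisfies (λ j → σ j ≟ 0) zerosPrefixClosed p≤z

module InsertionSites {n : ℕ} {σ : Seq} (1≤n : 1 ≤ n) (avoider : IsAvoider n σ)
                      (no1 : ∀ j → 1 ≤ j → j ≤ n → σ j ≢ 1) where

  private
    isInv : IsInvSeq n σ
    isInv = proj₁ avoider
    avoids010 : ¬ Contains010 n σ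
    avoids010 = proj₁ (proj₂ avoider)
    avoids102 : ¬ Contains102 n σ
    avoids102 = proj₂ (proj₂ avoider)

  σ₁≡0 : σ 1 ≡ 0
  σ₁≡0 = n<1⇒n≡0 (isInv 1 ≤-refl 1≤n)

  open ZeroPrefix σ₁≡0 avoids010

  1≤#zeros : 1 ≤ #zeros
  1≤#zeros = zero⇒≤#zeros ≤-refl 1≤n σ₁≡0

  1<after-zeros : ∀ {p} → #zeros < p → p ≤ n → 1 < σ p
  1<after-zeros {p} z<p p≤n = ≤∧≢⇒< (n≢0⇒n>0 σp≢0) (σp≢1 ∘ sym)
    where
    1≤p : 1 ≤ p
    1≤p = m<n⇒0<n z<p
    σp≢0 : σ p ≢ 0
    σp≢0 σp≡0 = <⇒≱ z<p (zero⇒≤#zeros 1≤p p≤n σp≡0)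
    σp≢1 : σ p ≢ 1
    σp≢1 = no1 p 1≤p p≤n

  sites⇒#zeros< : ∀ {i} → Sites n σ i → #zeros < i
  sites⇒#zeros< {i} (1<i , _ , _ , avoids010′ , _) = ≰⇒> λ i≤z →
    avoids010′ (1 , i , suc i , ≤-refl , 1<i , ≤-refl , s≤s (≤-trans i≤z #zeros≤n) ,
                τ₁≡τᵢ₊₁ i≤z , subst₂ _<_ (sym (τᵢ₊₁≡0 i≤z)) (sym (insertOne-≡ σ i)) z<s)
    where
    τᵢ₊₁≡0 : i ≤ #zeros → insertOne σ i (suc i) ≡ 0
    τᵢ₊₁≡0 i≤z = trans (insertOne-> σ ≤-refl) (≤#zeros⇒zero (<⇒≤ 1<i) i≤z)
    τ₁≡τᵢ₊₁ : i ≤ #zeros → insertOne σ i 1 ≡ insertOne σ i (suc i)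
    τ₁≡τᵢ₊₁ i≤z = trans (insertOne-< σ 1<i) (trans σ₁≡0 (sym (τᵢ₊₁≡0 i≤z)))

  sites⇒dominates : ∀ {i} → Sites n σ i → Dominates σ (suc #zeros) (pred i) i n
  sites⇒dominates {i} (1<i , i≤1+n , _ , _ , avoids102′) {p} {q} z<p p≤i-1 i≤q q≤n =
    ≮⇒≥ λ σp<σq →
      avoids102′ (p , i , suc q , m<n⇒0<n z<p , p<i , s≤s i≤q , s≤s q≤n ,
                  subst₂ _<_ (sym (insertOne-≡ σ i)) (sym τₚ≡σₚ) (1<after-zeros z<p p≤n) ,
                  subst₂ _<_ (sym τₚ≡σₚ) (sym (insertOne-> σ (s≤s i≤q))) σp<σq)
    where
    p<i : p < i
    p<i = m≤pred[n]⇒suc[m]≤n {{>-nonZero (<⇒≤ 1<i)}} p≤i-1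
    p≤n : p ≤ n
    p≤n = s≤s⁻¹ (<-≤-trans p<i i≤1+n)
    τₚ≡σₚ : insertOne σ i p ≡ σ p
    τₚ≡σₚ = insertOne-< σ p<i

  module _ {i : ℕ} (z<i : #zeros < i) (i≤1+n : i ≤ suc n) where

    1<insertOne-after : ∀ {q} → i < q → q ≤ suc n → 1 < insertOne σ i q
    1<insertOne-after i<q q≤1+n = subst (1 <_) (sym (insertOne-> σ i<q))
      (1<after-zeros (<-≤-trans z<i (<⇒≤pred i<q)) (pred-mono-≤ q≤1+n))

    ¬010-inserted-first : ∀ {b c} → ¬ Occurs Pattern010 (suc n) (insertOne σ i) i b c
    ¬010-inserted-first (_ , i<b , b<c , c≤1+n , τᵢ≡τc , _) =
      <⇒≢ (1<insertOne-after (<-trans i<b b<c) c≤1+n)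
          (trans (sym (insertOne-≡ σ i)) τᵢ≡τc)

    ¬010-inserted-middle : ∀ {a c} → ¬ Occurs Pattern010 (suc n) (insertOne σ i) a i c
    ¬010-inserted-middle {c = c} (_ , _ , i<c , c≤1+n , _ , τc<τᵢ) =
      <-asym (1<insertOne-after i<c c≤1+n)
             (subst (insertOne σ i c <_) (insertOne-≡ σ i) τc<τᵢ)

    ¬010-inserted-last : ∀ {a b} → ¬ Occurs Pattern010 (suc n) (insertOne σ i) a b i
    ¬010-inserted-last {a} (1≤a , a<b , b<i , _ , τa≡τᵢ , _) =
      no1 a 1≤a (s≤s⁻¹ (<-≤-trans a<i i≤1+n))
          (trans (sym (insertOne-< σ a<i)) (trans τa≡τᵢ (insertOne-≡ σ i)))
      where
      a<i : a < i
      a<i = <-trans a<b b<i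

    ¬102-inserted-first : ∀ {b c} → ¬ Occurs Pattern102 (suc n) (insertOne σ i) i b c
    ¬102-inserted-first {b} (_ , i<b , b<c , c≤1+n , τb<τᵢ , _) =
      <-asym (1<insertOne-after i<b (≤-trans (<⇒≤ b<c) c≤1+n))
             (subst (insertOne σ i b <_) (insertOne-≡ σ i) τb<τᵢ)

    ¬102-inserted-middle : Dominates σ (suc #zeros) (pred i) i n →
      ∀ {a c} → ¬ Occurs Pattern102 (suc n) (insertOne σ i) a i c
    ¬102-inserted-middle dominates {a} (1≤a , a<i , i<c , c≤1+n , τᵢ<τa , τa<τc) =
      <⇒≱ (subst₂ _<_ (insertOne-< σ a<i) (insertOne-> σ i<c) τa<τc)
          (dominates z<a (<⇒≤pred a<i) (<⇒≤pred i<c) (pred-mono-≤ c≤1+n))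
      where
      1<σa : 1 < σ a
      1<σa = subst₂ _<_ (insertOne-≡ σ i) (insertOne-< σ a<i) τᵢ<τa
      z<a : #zeros < a
      z<a = ≰⇒> λ a≤z → <⇒≢ (<-trans z<s 1<σa) (sym (≤#zeros⇒zero 1≤a a≤z))

    ¬102-inserted-last : ∀ {a b} → ¬ Occurs Pattern102 (suc n) (insertOne σ i) a b i
    ¬102-inserted-last {a} (_ , _ , _ , _ , τb<τa , τa<τᵢ) =
      n≮0 (<-≤-trans τb<τa (s≤s⁻¹ (subst (insertOne σ i a <_) (insertOne-≡ σ i) τa<τᵢ)))

  dominates⇒sites : ∀ {i} → #zeros < i → i ≤ suc n →
    Dominates σ (suc #zeros) (pred i) i n → Sites n σ i
  dominates⇒sites {i} z<i i≤1+n dominates =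
    1<i , i≤1+n , insertOne-isInvSeq 1<i i≤1+n isInv ,
    insertOne-avoids {Pattern010} 1≤i i≤1+n avoids010 (¬010-inserted-first z<i i≤1+n)
      (¬010-inserted-middle z<i i≤1+n) (¬010-inserted-last z<i i≤1+n) ,
    insertOne-avoids {Pattern102} 1≤i i≤1+n avoids102 (¬102-inserted-first z<i i≤1+n)
      (¬102-inserted-middle z<i i≤1+n dominates) (¬102-inserted-last z<i i≤1+n)
    where
    1<i : 1 < i
    1<i = ≤-<-trans 1≤#zeros z<i
    1≤i : 1 ≤ i
    1≤i = <⇒≤ 1<i

proposition4p4 : (n : ℕ) → 1 ≤ n → (σ : Seq) → IsAvoider n σ →
    (∀ j → 1 ≤ j → j ≤ n → σ j ≢ 1) →
    (i : ℕ) →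
    Sites n σ i ⇔
      (length (Zeros n σ) + 1 ≤ i × i ≤ n + 1 ×
       MinGeMax (rangeMin σ (length (Zeros n σ) + 1) (i ∸ 1)) (rangeMax σ i n))
proposition4p4 n 1≤n σ avoider no1 i rewrite +-comm (length (Zeros n σ)) 1 | +-comm n 1 = mk⇔
  (λ site → sites⇒#zeros< site , proj₁ (proj₂ site) ,
            Equivalence.from MinGeMax-range⇔ (sites⇒dominates site))
  (λ (z<i , i≤1+n , m≥M) → dominates⇒sites z<i i≤1+n (Equivalence.to MinGeMax-range⇔ m≥M))
  where open InsertionSites 1≤n avoider no1
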